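{- Let $n$ be a positive integer of the form $n = 2^k - 1$. Then for all positive integers $a, b, c$, the tripod nim position $(n,(a,b,c))$ is a $\mathcal{P}$-position if and only if $a \oplus b \oplus c = 0$ or $a = b = c = n$.
   Context: Tree nim: a position is a finite tree whose vertices carry positive integer sizes; a leaf is a vertex of degree at most $1$; a move chooses a leaf and decreases its size by a positive integer, deleting that vertex if its size becomes $0$ (so inner vertices become playable once they become leaves); normal play (the player unable to move loses). A position is $\mathcal{P}$ iff no move leads to a $\mathcal{P}$-position. Tripod nim: $(o,(a,b,c))$ denotes the tree nim position consisting of a central vertex of size $o$ adjacent to three leaves of sizes $a$, $b$, $c$. $\oplus$ denotes nim-sum: bitwise XOR of binary expansions (binary addition without carrying). -}

module Defs where

open import Data.Nat using (ℕ; zero; suc; _+_; _*_; _<_; _≤_)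
open import Data.Nat.DivMod using (_/_; _%_)
open import Data.List using (List; []; _∷_; length)
open import Data.Maybe using (Maybe; just; nothing)
open import Data.Product using (Σ; _×_; _,_)

-- Nim-sum (bitwise XOR) of natural numbers.
-- xorFuel f a b processes f binary digits; fuel a + b is always enough
-- (a number m has at most m binary digits).

xorFuel : ℕ → ℕ → ℕ → ℕ
xorFuel zero    a b = 0
xorFuel (suc f) a b = ((a % 2 + b % 2) % 2) + 2 * xorFuel f (a / 2) (b / 2)

_⊕_ : ℕ → ℕ → ℕ
a ⊕ b = xorFuel (a + b) a b

infixl 6 _⊕_

-- A finite tree is represented as a rose tree (rooted at an arbitrary
-- vertex); each vertex carries its size (a natural number, positive in
-- all positions that arise).  The root's degree is the number of its
-- children; a non-root vertex has degree (number of children + 1).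
-- Hence the root is a leaf iff it has ≤ 1 child, and a non-root vertex
-- is a leaf iff it has no children.
-- A position is a tree or the empty position (nothing).

data Tree : Set where
  node : ℕ → List Tree → Tree

consM : Maybe Tree → List Tree → List Tree
consM (just t) ts = t ∷ ts
consM nothing  ts = ts

mutual
  -- A move inside a subtree hanging below some parent vertex;
  -- result nothing = that subtree's root (a leaf) was deleted.
  data SubMove : Tree → Maybe Tree → Set where
    leafDec : ∀ {k j} → 0 < j → j < k → SubMove (node k []) (just (node j []))
    leafDel : ∀ {k} → 0 < k → SubMove (node k []) nothing
    inner   : ∀ {k cs cs'} → ChildrenMove cs cs' → SubMove (node k cs) (just (node k cs'))

  data ChildrenMove : List Tree → List Tree → Set where
    here  : ∀ {t t' ts} → SubMove t t' → ChildrenMove (t ∷ ts) (consM t' ts)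
    there : ∀ {t ts ts'} → ChildrenMove ts ts' → ChildrenMove (t ∷ ts) (t ∷ ts')

-- A move in a whole tree (the root is a leaf iff it has ≤ 1 child;
-- deleting a root with one child makes that child the new root).
data Move : Tree → Maybe Tree → Set where
  rootDec  : ∀ {k j cs} → length cs ≤ 1 → 0 < j → j < k →
             Move (node k cs) (just (node j cs))
  rootDel0 : ∀ {k} → 0 < k → Move (node k []) nothing
  rootDel1 : ∀ {k c} → 0 < k → Move (node k (c ∷ [])) (just c)
  sub      : ∀ {k cs cs'} → ChildrenMove cs cs' → Move (node k cs) (just (node k cs'))

data PMove : Maybe Tree → Maybe Tree → Set where
  pmove : ∀ {t p} → Move t p → PMove (just t) p

-- Since every
-- game is finite, this inductive definition coincides with
-- "P iff no move leads to a P-position".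
mutual
  data IsP (p : Maybe Tree) : Set where
    isP : (∀ q → PMove p q → IsN q) → IsP p

  data IsN (p : Maybe Tree) : Set where
    isN : ∀ q → PMove p q → IsP q → IsN p

tripod : ℕ → ℕ → ℕ → ℕ → Maybe Tree
tripod o a b c = just (node o (node a [] ∷ node b [] ∷ node c [] ∷ []))

-- Tree nim terminates (the total size drops with every move), so a set X of positions consists
-- exactly of the P-positions once no move leads from X into X and every position outside X has
-- a move into X; positions whose status is already known may serve as targets.  For the tripod
-- with centre n, X consists of the positions with a ⊕ b ⊕ c = 0 together with (n,(n,n,n)).
-- From such a position lowering a leg destroys this property, and deleting a leg leaves a path
-- x – n – y, which is a P-position exactly when x = y ≠ n.  From any other position Bouton's
-- lemma gives a leg x with y ⊕ z < x; the usual nim move fails only when y ⊕ z = 0, and the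
-- one non-obvious case is x < n = y = z, where y is lowered to x ⊕ n.  This is below n because
-- n = 2^k − 1 has all binary digits one, so x ⊕ n = n − x.

module Submission where

open import Algebra.Bundles using (AbelianGroup)
import Algebra.Properties.AbelianGroup as AbelianGroupProperties
open import Data.Empty using (⊥-elim)
open import Data.List using (List; []; _∷_)
open import Data.Maybe using (Maybe; just; nothing)
open import Data.Nat using (ℕ; zero; suc; _+_; _*_; _∸_; _^_; _≤_; _<_; z≤n; s≤s; _≟_; NonZero)
open import Data.Nat.DivMod
open import Data.Nat.Divisibility using (m∣m*n)
open import Data.Nat.Induction using (<-wellFounded)
open import Data.Nat.Properties
open import Data.Product using (Σ; ∃-syntax; _×_; _,_; proj₁; proj₂)
open import Data.Sum using (_⊎_; inj₁; inj₂)
import Data.Sum as Sum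
open import Defs
open import Function using (_∘_; flip; id)
open import Function.Bundles using (_⇔_; mk⇔)
open import Induction.WellFounded using (WellFounded; Acc; acc; module Subrelation)
open import Level using (0ℓ)
open import Relation.Binary.Construct.On using () renaming (wellFounded to on-wellFounded)
open import Relation.Binary.Definitions using (tri<; tri≈; tri>)
open import Relation.Binary.PropositionalEquality
open import Relation.Binary.PropositionalEquality.Algebra using (isMagma)
open import Relation.Nullary using (¬_; Dec; yes; no)
open import Relation.Nullary.Decidable using (_×-dec_; _⊎-dec_; decidable-stable)
open import Algebra.Definitions {A = ℕ} _≡_ using (Associative; Commutative; RightIdentity)
open import Algebra.Properties.CommutativeSemigroup +-commutativeSemigroup using (interchange)
open import Algebra.Structures {A = ℕ} _≡_ using (IsAbelianGroup)

private
  variable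
    a b c f g m n o x y z : ℕ

bit-split : ∀ m → m ≡ m % 2 + 2 * (m / 2)
bit-split m = trans (m≡m%n+[m/n]*n m 2) (cong (m % 2 +_) (*-comm (m / 2) 2))

%2≡0⊎%2≡1 : ∀ m → m % 2 ≡ 0 ⊎ m % 2 ≡ 1
%2≡0⊎%2≡1 m with m % 2 | m%n<n m 2
... | 0           | _               = inj₁ refl
... | 1           | _               = inj₂ refl
... | suc (suc _) | s≤s (s≤s ())

[r+2q]%2≡r : ∀ {r} q → r < 2 → (r + 2 * q) % 2 ≡ r
[r+2q]%2≡r {r} q r<2 = trans (cong (λ t → (r + t) % 2) (*-comm 2 q))
                             (trans ([m+kn]%n≡m%n r q 2) (m<n⇒m%n≡m r<2))

[r+2q]/2≡q : ∀ {r} q → r < 2 → (r + 2 * q) / 2 ≡ q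
[r+2q]/2≡q {r} q r<2 = trans (+-distrib-/-∣ʳ r (m∣m*n q))
                             (cong₂ _+_ (m<n⇒m/n≡0 r<2) (trans (cong (_/ 2) (*-comm 2 q)) (m*n/n≡m q 2)))

halves-injective : m % 2 ≡ n % 2 → m / 2 ≡ n / 2 → m ≡ n
halves-injective {m} {n} r≡ q≡ =
  trans (bit-split m) (trans (cong₂ (λ r q → r + 2 * q) r≡ q≡) (sym (bit-split n)))

halves-< : m / 2 ≡ n / 2 → m % 2 < n % 2 → m < n
halves-< {m} {n} q≡ r< = subst₂ _<_ (sym (bit-split m)) (sym (bit-split n))
  (subst (λ q → m % 2 + 2 * q < n % 2 + 2 * (n / 2)) (sym q≡) (+-monoˡ-< (2 * (n / 2)) r<))

m/2≡0⇒m≡1 : m / 2 ≡ 0 → m ≢ 0 → m ≡ 1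
m/2≡0⇒m≡1 {m} m/2≡0 m≢0 with %2≡0⊎%2≡1 m
... | inj₁ m-even = ⊥-elim (m≢0 (halves-injective m-even m/2≡0))
... | inj₂ m-odd  = halves-injective m-odd m/2≡0

/2-reflects-< : m / 2 < n / 2 → m < n
/2-reflects-< m/2<n/2 = ≰⇒> (λ n≤m → <⇒≱ m/2<n/2 (/-monoˡ-≤ 2 n≤m))

halve-≤ : m ≤ suc f → m / 2 ≤ f
halve-≤ {f = f} m≤1+f =
  <⇒≤pred (≤-<-trans (/-monoˡ-≤ 2 m≤1+f) (m/n<m (suc f) 2 (s≤s (s≤s z≤n))))

[m%d+n]%d≡[m+n]%d : ∀ m n d .{{_ : NonZero d}} → (m % d + n) % d ≡ (m + n) % d
[m%d+n]%d≡[m+n]%d m n d = trans (%-distribˡ-+ (m % d) n d)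
  (trans (cong (λ r → (r + n % d) % d) (m%n%n≡m%n m d)) (sym (%-distribˡ-+ m n d)))

[m+n%d]%d≡[m+n]%d : ∀ m n d .{{_ : NonZero d}} → (m + n % d) % d ≡ (m + n) % d
[m+n%d]%d≡[m+n]%d m n d = trans (cong (_% d) (+-comm m (n % d)))
  (trans ([m%d+n]%d≡[m+n]%d n m d) (cong (_% d) (+-comm n m)))

[[m+n]%d+o]%d≡[m+[n+o]%d]%d : ∀ m n o d .{{_ : NonZero d}} →
                               ((m + n) % d + o) % d ≡ (m + (n + o) % d) % d
[[m+n]%d+o]%d≡[m+[n+o]%d]%d m n o d = trans ([m%d+n]%d≡[m+n]%d (m + n) o d)
  (trans (cong (_% d) (+-assoc m n o)) (sym ([m+n%d]%d≡[m+n]%d m (n + o) d)))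

xorFuel-comm : ∀ f a b → xorFuel f a b ≡ xorFuel f b a
xorFuel-comm zero    a b = refl
xorFuel-comm (suc f) a b =
  cong₂ (λ r q → r % 2 + 2 * q) (+-comm (a % 2) (b % 2)) (xorFuel-comm f (a / 2) (b / 2))

xorFuel-self : ∀ f a → xorFuel f a a ≡ 0
xorFuel-self zero    a = refl
xorFuel-self (suc f) a = cong₂ (λ r q → r + 2 * q) [a+a]%2≡0 (xorFuel-self f (a / 2))
  where
  [a+a]%2≡0 : (a % 2 + a % 2) % 2 ≡ 0
  [a+a]%2≡0 = trans (cong (_% 2) (trans (cong (a % 2 +_) (sym (+-identityʳ (a % 2)))) (*-comm 2 (a % 2))))
                    (m*n%n≡0 (a % 2) 2)

xorFuel-stable : a ≤ f → b ≤ f → a ≤ g → b ≤ g → xorFuel f a b ≡ xorFuel g a b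
xorFuel-stable {f = zero}  {g = zero}  _   _   _   _   = refl
xorFuel-stable {f = zero}  {g = suc g} z≤n z≤n _   _   = sym (xorFuel-self (suc g) 0)
xorFuel-stable {f = suc f} {g = zero}  _   _   z≤n z≤n = xorFuel-self (suc f) 0
xorFuel-stable {a} {f = suc f} {b} {g = suc g} a≤f b≤f a≤g b≤g =
  cong (λ q → (a % 2 + b % 2) % 2 + 2 * q)
       (xorFuel-stable (halve-≤ a≤f) (halve-≤ b≤f) (halve-≤ a≤g) (halve-≤ b≤g))

xorFuel-enough : a ≤ f → b ≤ f → xorFuel f a b ≡ a ⊕ b
xorFuel-enough {a} {b = b} a≤f b≤f = xorFuel-stable a≤f b≤f (m≤m+n a b) (m≤n+m b a)

⊕-unfold : ∀ a b → a ⊕ b ≡ (a % 2 + b % 2) % 2 + 2 * (a / 2 ⊕ b / 2)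
⊕-unfold a b = begin
  a ⊕ b
    ≡⟨ xorFuel-enough (m≤n⇒m≤1+n (m≤m+n a b)) (m≤n⇒m≤1+n (m≤n+m b a)) ⟨
  xorFuel (suc (a + b)) a b
    ≡⟨ cong (λ q → (a % 2 + b % 2) % 2 + 2 * q) (xorFuel-enough a/2≤ b/2≤) ⟩
  (a % 2 + b % 2) % 2 + 2 * (a / 2 ⊕ b / 2) ∎
  where
  open ≡-Reasoning
  a/2≤ : a / 2 ≤ a + b
  a/2≤ = ≤-trans (m/n≤m a 2) (m≤m+n a b)
  b/2≤ : b / 2 ≤ a + b
  b/2≤ = ≤-trans (m/n≤m b 2) (m≤n+m b a)

⊕-%2 : ∀ a b → (a ⊕ b) % 2 ≡ (a % 2 + b % 2) % 2
⊕-%2 a b = trans (cong (_% 2) (⊕-unfold a b)) ([r+2q]%2≡r (a / 2 ⊕ b / 2) (m%n<n (a % 2 + b % 2) 2))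

⊕-/2 : ∀ a b → (a ⊕ b) / 2 ≡ a / 2 ⊕ b / 2
⊕-/2 a b = trans (cong (_/ 2) (⊕-unfold a b)) ([r+2q]/2≡q (a / 2 ⊕ b / 2) (m%n<n (a % 2 + b % 2) 2))

⊕-comm : Commutative _⊕_
⊕-comm a b = trans (cong (λ f → xorFuel f a b) (+-comm a b)) (xorFuel-comm (b + a) a b)

⊕-self : ∀ a → a ⊕ a ≡ 0
⊕-self a = xorFuel-self (a + a) a

⊕-identityʳ-≤ : ∀ f → a ≤ f → a ⊕ 0 ≡ a
⊕-identityʳ-≤ zero    z≤n = refl
⊕-identityʳ-≤ {a} (suc f) a≤ = halves-injective
  (trans (⊕-%2 a 0) (trans (cong (_% 2) (+-identityʳ (a % 2))) (m%n%n≡m%n a 2)))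
  (trans (⊕-/2 a 0) (⊕-identityʳ-≤ f (halve-≤ a≤)))

⊕-identityʳ : RightIdentity 0 _⊕_
⊕-identityʳ a = ⊕-identityʳ-≤ a ≤-refl

⊕-assoc-≤ : ∀ f → a ≤ f → b ≤ f → c ≤ f → a ⊕ b ⊕ c ≡ a ⊕ (b ⊕ c)
⊕-assoc-≤ zero z≤n z≤n z≤n = refl
⊕-assoc-≤ {a} {b} {c} (suc f) a≤ b≤ c≤ = halves-injective parity halves
  where
  open ≡-Reasoning
  parity : (a ⊕ b ⊕ c) % 2 ≡ (a ⊕ (b ⊕ c)) % 2
  parity = begin
    (a ⊕ b ⊕ c) % 2                   ≡⟨ ⊕-%2 (a ⊕ b) c ⟩
    ((a ⊕ b) % 2 + c % 2) % 2         ≡⟨ cong (λ r → (r + c % 2) % 2) (⊕-%2 a b) ⟩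
    ((a % 2 + b % 2) % 2 + c % 2) % 2 ≡⟨ [[m+n]%d+o]%d≡[m+[n+o]%d]%d (a % 2) (b % 2) (c % 2) 2 ⟩
    (a % 2 + (b % 2 + c % 2) % 2) % 2 ≡⟨ cong (λ r → (a % 2 + r) % 2) (⊕-%2 b c) ⟨
    (a % 2 + (b ⊕ c) % 2) % 2         ≡⟨ ⊕-%2 a (b ⊕ c) ⟨
    (a ⊕ (b ⊕ c)) % 2                 ∎
  halves : (a ⊕ b ⊕ c) / 2 ≡ (a ⊕ (b ⊕ c)) / 2
  halves = begin
    (a ⊕ b ⊕ c) / 2         ≡⟨ ⊕-/2 (a ⊕ b) c ⟩
    (a ⊕ b) / 2 ⊕ c / 2     ≡⟨ cong (_⊕ c / 2) (⊕-/2 a b) ⟩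
    a / 2 ⊕ b / 2 ⊕ c / 2   ≡⟨ ⊕-assoc-≤ f (halve-≤ a≤) (halve-≤ b≤) (halve-≤ c≤) ⟩
    a / 2 ⊕ (b / 2 ⊕ c / 2) ≡⟨ cong (a / 2 ⊕_) (⊕-/2 b c) ⟨
    a / 2 ⊕ (b ⊕ c) / 2     ≡⟨ ⊕-/2 a (b ⊕ c) ⟨
    (a ⊕ (b ⊕ c)) / 2       ∎

⊕-assoc : Associative _⊕_
⊕-assoc a b c = ⊕-assoc-≤ (a + b + c) (≤-trans (m≤m+n a b) (m≤m+n (a + b) c))
                                      (≤-trans (m≤n+m b a) (m≤m+n (a + b) c)) (m≤n+m c (a + b))

⊕-isAbelianGroup : IsAbelianGroup _⊕_ 0 id
⊕-isAbelianGroup = record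
  { isGroup = record
    { isMonoid = record
      { isSemigroup = record { isMagma = isMagma _⊕_ ; assoc = ⊕-assoc }
      ; identity    = (λ a → trans (⊕-comm 0 a) (⊕-identityʳ a)) , ⊕-identityʳ
      }
    ; inverse = ⊕-self , ⊕-self
    ; ⁻¹-cong = id
    }
  ; comm = ⊕-comm
  }

⊕-abelianGroup : AbelianGroup 0ℓ 0ℓ
⊕-abelianGroup = record { isAbelianGroup = ⊕-isAbelianGroup }

open AbelianGroupProperties ⊕-abelianGroup
  using (inverseˡ-unique; \\-leftDividesˡ; //-rightDividesʳ)

⊕≡0⇒≡ : x ⊕ y ≡ 0 → x ≡ y
⊕≡0⇒≡ = inverseˡ-unique _ _

-- Bouton's lemma

nimSum-/2 : ∀ a b c → (a ⊕ b ⊕ c) / 2 ≡ a / 2 ⊕ b / 2 ⊕ c / 2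
nimSum-/2 a b c = trans (⊕-/2 (a ⊕ b) c) (cong (_⊕ c / 2) (⊕-/2 a b))

⊕-even : a % 2 ≡ 0 → b % 2 ≡ 0 → (a ⊕ b) % 2 ≡ 0
⊕-even {a} {b} a-even b-even rewrite ⊕-%2 a b | a-even | b-even = refl

odd⇒⊕1< : x % 2 ≡ 1 → x ⊕ 1 < x
odd⇒⊕1< {x} x-odd = halves-< (trans (⊕-/2 x 1) (⊕-identityʳ (x / 2))) parity
  where
  parity : (x ⊕ 1) % 2 < x % 2
  parity rewrite ⊕-%2 x 1 | x-odd = s≤s z≤n

nimSum≡1⇒odd-leg : a ⊕ b ⊕ c ≡ 1 → a ⊕ 1 < a ⊎ b ⊕ 1 < b ⊎ c ⊕ 1 < c
nimSum≡1⇒odd-leg {a} {b} {c} s≡1 with %2≡0⊎%2≡1 a | %2≡0⊎%2≡1 b | %2≡0⊎%2≡1 c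
... | inj₂ a-odd  | _           | _           = inj₁ (odd⇒⊕1< a-odd)
... | inj₁ _      | inj₂ b-odd  | _           = inj₂ (inj₁ (odd⇒⊕1< b-odd))
... | inj₁ _      | inj₁ _      | inj₂ c-odd  = inj₂ (inj₂ (odd⇒⊕1< c-odd))
... | inj₁ a-even | inj₁ b-even | inj₁ c-even = ⊥-elim (0≢1+n (trans (sym s-even) (cong (_% 2) s≡1)))
  where
  s-even : (a ⊕ b ⊕ c) % 2 ≡ 0
  s-even = ⊕-even {a ⊕ b} (⊕-even {a} {b} a-even b-even) c-even

bouton-≤ : ∀ f → a ≤ f → b ≤ f → c ≤ f → a ⊕ b ⊕ c ≢ 0 →
           let s = a ⊕ b ⊕ c in a ⊕ s < a ⊎ b ⊕ s < b ⊎ c ⊕ s < c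
bouton-≤ zero z≤n z≤n z≤n s≢0 = ⊥-elim (s≢0 refl)
-- A leg reducing the halves also reduces the full legs; if the halves have nim-sum 0, the
-- nim-sum is 1 and any odd leg reduces.
bouton-≤ {a} {b} {c} (suc f) a≤ b≤ c≤ s≢0 with a / 2 ⊕ b / 2 ⊕ c / 2 ≟ 0
... | no s/2≢0 = Sum.map lift (Sum.map lift lift)
                         (bouton-≤ f (halve-≤ a≤) (halve-≤ b≤) (halve-≤ c≤) s/2≢0)
  where
  lift : x / 2 ⊕ (a / 2 ⊕ b / 2 ⊕ c / 2) < x / 2 → x ⊕ (a ⊕ b ⊕ c) < x
  lift {x} lt = /2-reflects-< (subst (_< x / 2) (sym halves) lt)
    where
    halves : (x ⊕ (a ⊕ b ⊕ c)) / 2 ≡ x / 2 ⊕ (a / 2 ⊕ b / 2 ⊕ c / 2)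
    halves = trans (⊕-/2 x (a ⊕ b ⊕ c)) (cong (x / 2 ⊕_) (nimSum-/2 a b c))
... | yes s/2≡0 =
  subst (λ s → a ⊕ s < a ⊎ b ⊕ s < b ⊎ c ⊕ s < c) (sym s≡1) (nimSum≡1⇒odd-leg s≡1)
  where
  s≡1 : a ⊕ b ⊕ c ≡ 1
  s≡1 = m/2≡0⇒m≡1 (trans (nimSum-/2 a b c) s/2≡0) s≢0

nimSum≢0⇒reducible : a ⊕ b ⊕ c ≢ 0 → b ⊕ c < a ⊎ a ⊕ c < b ⊎ a ⊕ b < c
nimSum≢0⇒reducible {a} {b} {c} s≢0 =
  Sum.map (subst (_< a) (a⊕s≡ a b c)) (Sum.map (subst (_< b) b⊕s≡) (subst (_< c) c⊕s≡))
          (bouton-≤ (a + b + c) (≤-trans (m≤m+n a b) (m≤m+n (a + b) c))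
                    (≤-trans (m≤n+m b a) (m≤m+n (a + b) c)) (m≤n+m c (a + b)) s≢0)
  where
  a⊕s≡ : ∀ a b c → a ⊕ (a ⊕ b ⊕ c) ≡ b ⊕ c
  a⊕s≡ a b c = trans (cong (a ⊕_) (⊕-assoc a b c)) (\\-leftDividesˡ a (b ⊕ c))
  b⊕s≡ : b ⊕ (a ⊕ b ⊕ c) ≡ a ⊕ c
  b⊕s≡ = trans (cong (λ t → b ⊕ (t ⊕ c)) (⊕-comm a b)) (a⊕s≡ b a c)
  c⊕s≡ : c ⊕ (a ⊕ b ⊕ c) ≡ a ⊕ b
  c⊕s≡ = trans (⊕-comm c _) (//-rightDividesʳ c (a ⊕ b))

data AllOnes : ℕ → Set where
  ones-zero : AllOnes 0
  ones-suc  : AllOnes m → AllOnes (1 + 2 * m)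

2^k∸1-allOnes : ∀ k → AllOnes (2 ^ k ∸ 1)
2^k∸1-allOnes zero = ones-zero
2^k∸1-allOnes (suc k) with 2 ^ k | m^n>0 2 k | 2^k∸1-allOnes k
... | suc p | _ | ones = subst AllOnes (sym (+-suc p (p + 0))) (ones-suc ones)

⊕-allOnes : AllOnes n → x ≤ n → x ⊕ n + x ≡ n
⊕-allOnes ones-zero z≤n = refl
⊕-allOnes {n} {x} (ones-suc {m} ones) x≤n = begin
  x ⊕ n + x
    ≡⟨ cong₂ _+_ (⊕-unfold x n) (bit-split x) ⟩
  ((x % 2 + n % 2) % 2 + 2 * (x / 2 ⊕ n / 2)) + (x % 2 + 2 * (x / 2))
    ≡⟨ cong₂ (λ r h → ((x % 2 + r) % 2 + 2 * (x / 2 ⊕ h)) + (x % 2 + 2 * (x / 2))) (n%2≡1) (n/2≡m) ⟩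
  ((x % 2 + 1) % 2 + 2 * (x / 2 ⊕ m)) + (x % 2 + 2 * (x / 2))
    ≡⟨ interchange ((x % 2 + 1) % 2) (2 * (x / 2 ⊕ m)) (x % 2) (2 * (x / 2)) ⟩
  ((x % 2 + 1) % 2 + x % 2) + (2 * (x / 2 ⊕ m) + 2 * (x / 2))
    ≡⟨ cong₂ _+_ flipped-bit doubled-halves ⟩
  1 + 2 * m ∎
  where
  open ≡-Reasoning
  n%2≡1 : n % 2 ≡ 1
  n%2≡1 = [r+2q]%2≡r m (s≤s (s≤s z≤n))
  n/2≡m : n / 2 ≡ m
  n/2≡m = [r+2q]/2≡q m (s≤s (s≤s z≤n))
  x/2≤m : x / 2 ≤ m
  x/2≤m = subst (x / 2 ≤_) n/2≡m (/-monoˡ-≤ 2 x≤n)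
  doubled-halves : 2 * (x / 2 ⊕ m) + 2 * (x / 2) ≡ 2 * m
  doubled-halves = trans (sym (*-distribˡ-+ 2 (x / 2 ⊕ m) (x / 2))) (cong (2 *_) (⊕-allOnes ones x/2≤m))
  flipped-bit : (x % 2 + 1) % 2 + x % 2 ≡ 1
  flipped-bit with %2≡0⊎%2≡1 x
  ... | inj₁ x-even rewrite x-even = refl
  ... | inj₂ x-odd  rewrite x-odd  = refl

⊕-allOnes-< : AllOnes n → 0 < x → x < n → x ⊕ n < n
⊕-allOnes-< {n} {x} ones x>0 x<n = subst (x ⊕ n <_) (⊕-allOnes ones (<⇒≤ x<n)) (m<m+n (x ⊕ n) x>0)

-- Tree nim

Position : Set
Position = Maybe Tree

leaf : ℕ → Tree
leaf x = node x []

path₂ : ℕ → ℕ → Position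
path₂ o y = just (node o (leaf y ∷ []))

path₃ : ℕ → ℕ → ℕ → Position
path₃ x o y = just (node o (leaf x ∷ leaf y ∷ []))

P⇒¬N : ∀ {p} → IsP p → ¬ IsN p
P⇒¬N (isP moves) (isN q p→q q-P) = P⇒¬N q-P (moves q p→q)

treeWeight : Tree → ℕ
forestWeight : List Tree → ℕ

treeWeight (node k ts) = k + forestWeight ts

forestWeight []       = 0
forestWeight (t ∷ ts) = treeWeight t + forestWeight ts

weight : Position → ℕ
weight nothing  = 0
weight (just t) = treeWeight t

forestWeight-consM : ∀ p ts → forestWeight (consM p ts) ≡ weight p + forestWeight ts
forestWeight-consM nothing  ts = refl
forestWeight-consM (just t) ts = refl

subMove-weight : ∀ {t p} → SubMove t p → weight p < treeWeight t
childrenMove-weight : ∀ {ts us} → ChildrenMove ts us → forestWeight us < forestWeight ts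

subMove-weight (leafDec _ j<k) = +-monoˡ-< 0 j<k
subMove-weight (leafDel k>0)   = ≤-trans k>0 (m≤m+n _ 0)
subMove-weight (inner {k} m)   = +-monoʳ-< k (childrenMove-weight m)

childrenMove-weight (here {t} {t′} {ts} m) =
  subst (_< treeWeight t + forestWeight ts) (sym (forestWeight-consM t′ ts))
        (+-monoˡ-< (forestWeight ts) (subMove-weight m))
childrenMove-weight (there {t} m) = +-monoʳ-< (treeWeight t) (childrenMove-weight m)

move-weight : ∀ {t p} → Move t p → weight p < treeWeight t
move-weight (rootDec _ _ j<k)      = +-monoˡ-< _ j<k
move-weight (rootDel0 k>0)         = ≤-trans k>0 (m≤m+n _ 0)
move-weight (rootDel1 {k} {c} k>0) = ≤-trans (m<n+m (treeWeight c) k>0) (+-monoʳ-≤ k (m≤m+n (treeWeight c) 0))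
move-weight (sub {k} m)            = +-monoʳ-< k (childrenMove-weight m)

PMove-wellFounded : WellFounded (flip PMove)
PMove-wellFounded = Subrelation.wellFounded weight-decreases (on-wellFounded weight <-wellFounded)
  where
  weight-decreases : ∀ {q p} → PMove p q → weight q < weight p
  weight-decreases (pmove m) = move-weight m

-- Positions outside the domain D may only be used if their status is already known.
PredictedP PredictedN : {D : Position → Set} → (∀ p → D p → Set) → Position → Set
PredictedP {D} X q = IsP q ⊎ Σ (D q) (X q)
PredictedN {D} X q = IsN q ⊎ Σ (D q) (λ e → ¬ X q e)

record Characterisation {D : Position → Set} (X : ∀ p → D p → Set) : Set where
  field
    X⇒moves-to-N : ∀ {p q} (d : D p) → X p d → PMove p q → PredictedN X q
    ¬X⇒move-to-P : ∀ {p} (d : D p) → ¬ X p d → ∃[ q ] PMove p q × PredictedP X q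

module _ {D : Position → Set} {X : ∀ p → D p → Set} (ch : Characterisation X) where
  open Characterisation ch

  characterise : ∀ {p} (d : D p) → (X p d → IsP p) × (¬ X p d → IsN p)
  characterise d = go (PMove-wellFounded _) d
    where
    go : ∀ {p} → Acc (flip PMove) p → (d : D p) → (X p d → IsP p) × (¬ X p d → IsN p)
    go {p} (acc rec) d = X⇒P , ¬X⇒N
      where
      predictedN : ∀ {q} → PMove p q → PredictedN X q → IsN q
      predictedN _ (inj₁ q-N)      = q-N
      predictedN m (inj₂ (e , ¬x)) = proj₂ (go (rec m) e) ¬x

      predictedP : ∀ {q} → PMove p q → PredictedP X q → IsP q
      predictedP _ (inj₁ q-P)     = q-P
      predictedP m (inj₂ (e , x)) = proj₁ (go (rec m) e) x

      X⇒P : X p d → IsP p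
      X⇒P x = isP λ q m → predictedN m (X⇒moves-to-N d x m)

      ¬X⇒N : ¬ X p d → IsN p
      ¬X⇒N ¬x = let q , m , q-P = ¬X⇒move-to-P d ¬x in isN q m (predictedP m q-P)

  characterise-⇔ : (∀ {p} (d : D p) → Dec (X p d)) → ∀ {p} (d : D p) → IsP p ⇔ X p d
  characterise-⇔ X? d = mk⇔ (λ p-P → decidable-stable (X? d) (P⇒¬N p-P ∘ proj₂ (characterise d)))
                            (proj₁ (characterise d))

single-N : 0 < x → IsN (just (leaf x))
single-N x>0 = isN nothing (pmove (rootDel0 x>0)) (isP λ _ ())

data PositivePath₂ : Position → Set where
  positive : 0 < o → 0 < y → PositivePath₂ (path₂ o y)

EndsEqual : ∀ p → PositivePath₂ p → Set
EndsEqual _ (positive {o} {y} _ _) = o ≡ y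

path₂-characterisation : Characterisation EndsEqual
path₂-characterisation = record { X⇒moves-to-N = moves ; ¬X⇒move-to-P = move }
  where
  moves : ∀ {p q} (d : PositivePath₂ p) → EndsEqual p d → PMove p q → PredictedN EndsEqual q
  moves (positive o>0 _) refl (pmove (rootDec _ j>0 j<o)) =
    inj₂ (positive j>0 o>0 , λ j≡o → <-irrefl j≡o j<o)
  moves (positive o>0 _) refl (pmove (rootDel1 _)) = inj₁ (single-N o>0)
  moves (positive o>0 _) refl (pmove (sub (here (leafDec j>0 j<o)))) =
    inj₂ (positive o>0 j>0 , λ o≡j → <-irrefl (sym o≡j) j<o)
  moves (positive o>0 _) refl (pmove (sub (here (leafDel _)))) = inj₁ (single-N o>0)

  move : ∀ {p} (d : PositivePath₂ p) → ¬ EndsEqual p d → ∃[ q ] PMove p q × PredictedP EndsEqual q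
  move (positive {o} {y} o>0 y>0) o≢y with <-cmp o y
  ... | tri< o<y _ _ = _ , pmove (sub (here (leafDec o>0 o<y))) , inj₂ (positive o>0 o>0 , refl)
  ... | tri≈ _ o≡y _ = ⊥-elim (o≢y o≡y)
  ... | tri> _ _ y<o = _ , pmove (rootDec (s≤s z≤n) y>0 y<o) , inj₂ (positive y>0 y>0 , refl)

path₂-P : 0 < o → IsP (path₂ o o)
path₂-P o>0 = proj₁ (characterise path₂-characterisation (positive o>0 o>0)) refl

path₂-N : 0 < o → 0 < y → o ≢ y → IsN (path₂ o y)
path₂-N o>0 y>0 = proj₂ (characterise path₂-characterisation (positive o>0 y>0))

data PositivePath₃ (o : ℕ) : Position → Set where
  positive : 0 < x → 0 < y → PositivePath₃ o (path₃ x o y)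

EqualLegs≢Centre : ∀ {o} p → PositivePath₃ o p → Set
EqualLegs≢Centre {o} _ (positive {x} {y} _ _) = x ≡ y × x ≢ o

path₃-characterisation : 0 < o → Characterisation (EqualLegs≢Centre {o})
path₃-characterisation {o} o>0 = record { X⇒moves-to-N = moves ; ¬X⇒move-to-P = move }
  where
  moves : ∀ {p q} (d : PositivePath₃ o p) → EqualLegs≢Centre p d → PMove p q →
          PredictedN (EqualLegs≢Centre {o}) q
  moves (positive _ _) _ (pmove (rootDec (s≤s ()) _ _))
  moves (positive _ x>0) (refl , _) (pmove (sub (here (leafDec x′>0 x′<x)))) =
    inj₂ (positive x′>0 x>0 , λ (x′≡x , _) → <-irrefl x′≡x x′<x)
  moves (positive x>0 _) (refl , x≢o) (pmove (sub (here (leafDel _)))) =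
    inj₁ (path₂-N o>0 x>0 (x≢o ∘ sym))
  moves (positive x>0 _) (refl , _) (pmove (sub (there (here (leafDec x′>0 x′<x))))) =
    inj₂ (positive x>0 x′>0 , λ (x≡x′ , _) → <-irrefl (sym x≡x′) x′<x)
  moves (positive x>0 _) (refl , x≢o) (pmove (sub (there (here (leafDel _))))) =
    inj₁ (path₂-N o>0 x>0 (x≢o ∘ sym))

  move : ∀ {p} (d : PositivePath₃ o p) → ¬ EqualLegs≢Centre p d →
         ∃[ q ] PMove p q × PredictedP (EqualLegs≢Centre {o}) q
  move (positive {x} {y} x>0 y>0) ¬X with <-cmp x y | x ≟ o | y ≟ o
  ... | tri≈ _ refl _ | yes refl | _       = _ , pmove (sub (here (leafDel x>0))) , inj₁ (path₂-P o>0)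
  ... | tri≈ _ refl _ | no x≢o   | _       = ⊥-elim (¬X (refl , x≢o))
  ... | tri< _ _ _    | yes refl | _       = _ , pmove (sub (there (here (leafDel y>0)))) , inj₁ (path₂-P o>0)
  ... | tri< x<y _ _  | no x≢o   | _       =
    _ , pmove (sub (there (here (leafDec x>0 x<y)))) , inj₂ (positive x>0 x>0 , refl , x≢o)
  ... | tri> _ _ _    | _        | yes refl = _ , pmove (sub (here (leafDel x>0))) , inj₁ (path₂-P o>0)
  ... | tri> _ _ y<x  | _        | no y≢o  =
    _ , pmove (sub (here (leafDec y>0 y<x))) , inj₂ (positive y>0 y>0 , refl , y≢o)

path₃-P : 0 < o → 0 < x → x ≢ o → IsP (path₃ x o x)
path₃-P o>0 x>0 x≢o = proj₁ (characterise (path₃-characterisation o>0) (positive x>0 x>0)) (refl , x≢o)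

path₃-N : 0 < o → 0 < x → 0 < y → ¬ (x ≡ y × x ≢ o) → IsN (path₃ x o y)
path₃-N o>0 x>0 y>0 = proj₂ (characterise (path₃-characterisation o>0) (positive x>0 y>0))

-- Tripods

Balanced : ℕ → ℕ → ℕ → ℕ → Set
Balanced n a b c = (a ⊕ b ⊕ c ≡ 0) ⊎ (a ≡ n × b ≡ n × c ≡ n)

nimSum≡0⇒≡⊕ : a ⊕ b ⊕ c ≡ 0 → a ≡ b ⊕ c
nimSum≡0⇒≡⊕ {a} {b} {c} s≡0 = ⊕≡0⇒≡ (trans (sym (⊕-assoc a b c)) s≡0)

≡⊕⇒nimSum≡0 : a ≡ b ⊕ c → a ⊕ b ⊕ c ≡ 0
≡⊕⇒nimSum≡0 {b = b} {c} refl = trans (⊕-assoc (b ⊕ c) b c) (⊕-self (b ⊕ c))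

balanced-swap : Balanced n x y z → Balanced n y x z
balanced-swap {x = x} {y} {z} (inj₁ s≡0)              = inj₁ (trans (cong (_⊕ z) (⊕-comm y x)) s≡0)
balanced-swap                 (inj₂ (x≡n , y≡n , z≡n)) = inj₂ (y≡n , x≡n , z≡n)

balanced-rotate : Balanced n x y z → Balanced n y z x
balanced-rotate {x = x} {y} {z} (inj₁ s≡0) =
  inj₁ (trans (trans (⊕-comm (y ⊕ z) x) (sym (⊕-assoc x y z))) s≡0)
balanced-rotate (inj₂ (x≡n , y≡n , z≡n)) = inj₂ (y≡n , z≡n , x≡n)

balanced-lower : ∀ {x′} → 0 < x′ → x′ < x → Balanced n x y z → ¬ Balanced n x′ y z
balanced-lower _ x′<x (inj₁ s≡0) (inj₁ s′≡0) =
  <-irrefl (trans (nimSum≡0⇒≡⊕ s′≡0) (sym (nimSum≡0⇒≡⊕ s≡0))) x′<x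
balanced-lower {n = n} x′>0 _ (inj₂ (_ , refl , refl)) (inj₁ s′≡0) =
  <-irrefl (sym (trans (nimSum≡0⇒≡⊕ s′≡0) (⊕-self n))) x′>0
balanced-lower {n = n} _ x′<x (inj₁ s≡0) (inj₂ (_ , refl , refl)) =
  n≮0 (subst (_ <_) (trans (nimSum≡0⇒≡⊕ s≡0) (⊕-self n)) x′<x)
balanced-lower _ x′<x (inj₂ (refl , _)) (inj₂ (refl , _)) = <-irrefl refl x′<x

balanced-equal-legs : 0 < x → Balanced n x y z → ¬ (y ≡ z × y ≢ n)
balanced-equal-legs {y = y} x>0 (inj₁ s≡0) (refl , _) =
  <-irrefl (sym (trans (nimSum≡0⇒≡⊕ s≡0) (⊕-self y))) x>0
balanced-equal-legs _ (inj₂ (_ , y≡n , _)) (_ , y≢n) = y≢n y≡n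

data BalancingMove (n x y z : ℕ) : Set where
  lower-leg  : ∀ {x′} → 0 < x′ → x′ < x → Balanced n x′ y z → BalancingMove n x y z
  delete-leg : y ≡ z → y ≢ n → BalancingMove n x y z
  lower-next : ∀ {y′} → 0 < y′ → y′ < y → Balanced n x y′ z → BalancingMove n x y z

data PositiveTripod (n : ℕ) : Position → Set where
  positive : 0 < a → 0 < b → 0 < c → PositiveTripod n (tripod n a b c)

TripodBalanced : ∀ {n} p → PositiveTripod n p → Set
TripodBalanced {n} _ (positive {a} {b} {c} _ _ _) = Balanced n a b c

tripodBalanced? : ∀ {n p} (d : PositiveTripod n p) → Dec (TripodBalanced p d)
tripodBalanced? {n} (positive {a} {b} {c} _ _ _) =
  (a ⊕ b ⊕ c ≟ 0) ⊎-dec (a ≟ n ×-dec b ≟ n ×-dec c ≟ n)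

module _ {n : ℕ} (ones : AllOnes n) (n>0 : 0 < n) where

  balancing-move : ¬ Balanced n x y z → y ⊕ z < x → BalancingMove n x y z
  balancing-move {x} {y} {z} ¬bal y⊕z<x with y ⊕ z ≟ 0
  ... | no y⊕z≢0 = lower-leg (n≢0⇒n>0 y⊕z≢0) y⊕z<x (inj₁ (≡⊕⇒nimSum≡0 {b = y} {z} refl))
  ... | yes y⊕z≡0 with ⊕≡0⇒≡ {y} {z} y⊕z≡0
  ...   | refl with y ≟ n
  ...     | no y≢n = delete-leg refl y≢n
  ...     | yes refl with <-cmp x n
  ...       | tri< x<n _ _ = lower-next x⊕n>0 (⊕-allOnes-< ones x>0 x<n)
                                          (inj₁ (≡⊕⇒nimSum≡0 {b = x ⊕ n} {n} (sym (//-rightDividesʳ n x))))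
    where
    x>0 : 0 < x
    x>0 = ≤-<-trans z≤n y⊕z<x
    x⊕n>0 : 0 < x ⊕ n
    x⊕n>0 = n≢0⇒n>0 (λ x⊕n≡0 → <-irrefl (⊕≡0⇒≡ x⊕n≡0) x<n)
  ...       | tri≈ _ refl _ = ⊥-elim (¬bal (inj₂ (refl , refl , refl)))
  ...       | tri> _ _ n<x = lower-leg n>0 n<x (inj₂ (refl , refl , refl))

  tripod-characterisation : Characterisation (TripodBalanced {n})
  tripod-characterisation = record { X⇒moves-to-N = moves ; ¬X⇒move-to-P = move }
    where
    rotate² : Balanced n x y z → Balanced n z x y
    rotate² = balanced-rotate ∘ balanced-rotate

    moves : ∀ {p q} (d : PositiveTripod n p) → TripodBalanced p d → PMove p q → PredictedN TripodBalanced q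
    moves (positive _ _ _) _ (pmove (rootDec (s≤s ()) _ _))
    moves (positive a>0 b>0 c>0) bal (pmove (sub (here (leafDec a′>0 a′<a)))) =
      inj₂ (positive a′>0 b>0 c>0 , balanced-lower a′>0 a′<a bal)
    moves (positive a>0 b>0 c>0) bal (pmove (sub (here (leafDel _)))) =
      inj₁ (path₃-N n>0 b>0 c>0 (balanced-equal-legs a>0 bal))
    moves (positive a>0 b>0 c>0) bal (pmove (sub (there (here (leafDec b′>0 b′<b))))) =
      inj₂ (positive a>0 b′>0 c>0 , balanced-lower b′>0 b′<b (balanced-swap bal) ∘ balanced-swap)
    moves (positive a>0 b>0 c>0) bal (pmove (sub (there (here (leafDel _))))) =
      inj₁ (path₃-N n>0 a>0 c>0 (balanced-equal-legs b>0 (balanced-swap bal)))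
    moves (positive a>0 b>0 c>0) bal (pmove (sub (there (there (here (leafDec c′>0 c′<c)))))) =
      inj₂ (positive a>0 b>0 c′>0 , balanced-lower c′>0 c′<c (rotate² bal) ∘ rotate²)
    moves (positive a>0 b>0 c>0) bal (pmove (sub (there (there (here (leafDel _)))))) =
      inj₁ (path₃-N n>0 a>0 b>0 (balanced-equal-legs c>0 (rotate² bal)))

    move : ∀ {p} (d : PositiveTripod n p) → ¬ TripodBalanced p d →
           ∃[ q ] PMove p q × PredictedP TripodBalanced q
    move (positive {a} {b} {c} a>0 b>0 c>0) ¬bal =
      Sum.[ via-a ∘ balancing-move ¬bal
          , Sum.[ via-b ∘ balancing-move (¬bal ∘ balanced-swap)
                , via-c ∘ balancing-move (¬bal ∘ balanced-rotate) ] ]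
        (nimSum≢0⇒reducible (¬bal ∘ inj₁))
      where
      Result : Set
      Result = ∃[ q ] PMove (tripod n a b c) q × PredictedP TripodBalanced q

      via-a : BalancingMove n a b c → Result
      via-a (lower-leg a′>0 a′<a bal) =
        _ , pmove (sub (here (leafDec a′>0 a′<a))) , inj₂ (positive a′>0 b>0 c>0 , bal)
      via-a (delete-leg refl b≢n) =
        _ , pmove (sub (here (leafDel a>0))) , inj₁ (path₃-P n>0 b>0 b≢n)
      via-a (lower-next b′>0 b′<b bal) =
        _ , pmove (sub (there (here (leafDec b′>0 b′<b)))) , inj₂ (positive a>0 b′>0 c>0 , bal)

      via-b : BalancingMove n b a c → Result
      via-b (lower-leg b′>0 b′<b bal) =
        _ , pmove (sub (there (here (leafDec b′>0 b′<b))))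
          , inj₂ (positive a>0 b′>0 c>0 , balanced-swap bal)
      via-b (delete-leg refl a≢n) =
        _ , pmove (sub (there (here (leafDel b>0)))) , inj₁ (path₃-P n>0 a>0 a≢n)
      via-b (lower-next a′>0 a′<a bal) =
        _ , pmove (sub (here (leafDec a′>0 a′<a))) , inj₂ (positive a′>0 b>0 c>0 , balanced-swap bal)

      via-c : BalancingMove n c a b → Result
      via-c (lower-leg c′>0 c′<c bal) =
        _ , pmove (sub (there (there (here (leafDec c′>0 c′<c)))))
          , inj₂ (positive a>0 b>0 c′>0 , balanced-rotate bal)
      via-c (delete-leg refl a≢n) =
        _ , pmove (sub (there (there (here (leafDel c>0))))) , inj₁ (path₃-P n>0 a>0 a≢n)
      via-c (lower-next a′>0 a′<a bal) =
        _ , pmove (sub (here (leafDec a′>0 a′<a))) , inj₂ (positive a′>0 b>0 c>0 , balanced-rotate bal)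

mainTheorem9 : (k n : ℕ) → n ≡ 2 ^ k ∸ 1 → 0 < n →
    (a b c : ℕ) → 0 < a → 0 < b → 0 < c →
    IsP (tripod n a b c) ⇔ ((a ⊕ b ⊕ c ≡ 0) ⊎ (a ≡ n × b ≡ n × c ≡ n))
mainTheorem9 k n n≡2^k∸1 n>0 a b c a>0 b>0 c>0 =
  characterise-⇔ (tripod-characterisation ones n>0) tripodBalanced? (positive a>0 b>0 c>0)
  where
  ones : AllOnes n
  ones = subst AllOnes (sym n≡2^k∸1) (2^k∸1-allOnes k)
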